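{- Let $\mathbf{e}$ be a transitive relation on a finite set $E$, let $(a,b,U),(c,c,V)\in\mathcal{F}(\mathbf{e})$, and set $\mathbf{p}=\mathbf{p}_{a,b,U}$, $\mathbf{q}=\mathbf{p}_{c,c,V}$, $U^{\mathsf c}=[a,b]\setminus U$, $V^{\mathsf c}=[c,c]\setminus V$. Then $\mathbf{p}\nearrow\mathbf{q}^{\perp}$ in $\mathrm{Reg}(\mathbf{e})$ if and only if $a=b=c$, $U\cap V\subseteq\{a\}$, and $U^{\mathsf c}\cap V^{\mathsf c}\subseteq\{a\}$.
   Context: A transitive relation $\mathbf{e}$ on $E$ is viewed as a set of ordered pairs. Write $x\lhd y$ if $(x,y)\in\mathbf{e}$, $x\unlhd y$ if ($x\lhd y$ or $x=y$), and $[a,b]=\{x: a\unlhd x\unlhd b\}$. A subset $\mathbf{a}\subseteq\mathbf{e}$ is closed if transitive, open if $\mathbf{e}\setminus\mathbf{a}$ is transitive; $\mathrm{cl}$ is transitive closure, $\mathrm{int}(\mathbf{a})$ the largest open subset; regular closed means $\mathbf{a}=\mathrm{cl}(\mathrm{int}(\mathbf{a}))$. $\mathrm{Reg}(\mathbf{e})$ is the lattice of regular closed subsets under inclusion; $\mathbf{x}^{\perp}=\mathrm{cl}(\mathbf{e}\setminus\mathbf{x})$ is an orthocomplementation (order-reversing involution) on it, so $\mathbf{q}^\perp$ is meet-irreducible whenever $\mathbf{q}$ is join-irreducible. $\mathcal{F}(\mathbf{e})$ is the set of triples $(a,b,U)$ with $(a,b)\in\mathbf{e}$, $U\subseteq[a,b]$,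 and such that $a\neq b$ implies $a\notin U$ and $b\in U$; $\mathbf{p}_{a,b,U}=\mathbf{e}\cap\big((\{a\}\cup ([a,b]\setminus U))\times(\{b\}\cup U)\big)$ (these are join-irreducible in $\mathrm{Reg}(\mathbf{e})$). For a join-irreducible $p$ and a meet-irreducible $u$ with unique upper cover $u^*$ in a finite lattice, $p\nearrow u$ means $p\le u^*$ and $p\not\le u$. -}

module Defs where

open import Data.Nat using (ℕ)
open import Data.Fin using (Fin)
open import Data.Bool using (Bool; T)
open import Data.Product using (Σ; _×_; _,_)
open import Data.Sum using (_⊎_)
open import Relation.Nullary using (¬_)
open import Relation.Binary.PropositionalEquality using (_≡_)

-- The finite set E is Fin n.
-- A (decidable) subset of E × E, i.e. a set of ordered pairs.
Sub : ℕ → Set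
Sub n = Fin n → Fin n → Bool

SubE : ℕ → Set
SubE n = Fin n → Bool

Rel₀ : ℕ → Set₁
Rel₀ n = Fin n → Fin n → Set

module _ {n : ℕ} where

  ⌊_⌋ : Sub n → Rel₀ n
  ⌊ b ⌋ x y = T (b x y)

  infix 4 _⊆_ _≐_
  _⊆_ : Rel₀ n → Rel₀ n → Set
  A ⊆ B = ∀ x y → A x y → B x y

  _≐_ : Rel₀ n → Rel₀ n → Set
  A ≐ B = (A ⊆ B) × (B ⊆ A)

  Transitive : Rel₀ n → Set
  Transitive A = ∀ x y z → A x y → A y z → A x z

  -- transitive closure cl
  data TC (A : Rel₀ n) : Rel₀ n where
    step  : ∀ {x y} → A x y → TC A x y
    trans : ∀ {x y z} → TC A x y → TC A y z → TC A x z

  module _ (e : Sub n) where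

    diff : Rel₀ n → Rel₀ n
    diff A x y = T (e x y) × ¬ A x y

    Open : Rel₀ n → Set
    Open A = Transitive (diff A)

    Int : Rel₀ n → Rel₀ n
    Int A x y = Σ (Sub n) λ b → (⌊ b ⌋ ⊆ A) × Open ⌊ b ⌋ × T (b x y)

    Reg : Rel₀ n → Set
    Reg A = (A ⊆ ⌊ e ⌋) × (A ≐ TC (Int A))

    _⊥ : Rel₀ n → Rel₀ n
    A ⊥ = TC (diff A)

    _⊴_ : Fin n → Fin n → Set
    x ⊴ y = T (e x y) ⊎ x ≡ y

    _∈[_,_] : Fin n → Fin n → Fin n → Set
    x ∈[ a , b ] = (a ⊴ x) × (x ⊴ b)

    InF : Fin n → Fin n → SubE n → Set
    InF a b U = T (e a b)
              × (∀ x → T (U x) → x ∈[ a , b ])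
              × (¬ a ≡ b → ¬ T (U a) × T (U b))

    pJ : Fin n → Fin n → SubE n → Rel₀ n
    pJ a b U x y = T (e x y)
                 × (x ≡ a ⊎ (x ∈[ a , b ] × ¬ T (U x)))
                 × (y ≡ b ⊎ T (U y))

    UpperCover : Rel₀ n → Sub n → Set
    UpperCover u w = Reg ⌊ w ⌋ × (u ⊆ ⌊ w ⌋) × ¬ (⌊ w ⌋ ⊆ u)
                   × (∀ (z : Sub n) → Reg ⌊ z ⌋ → u ⊆ ⌊ z ⌋ → ⌊ z ⌋ ⊆ ⌊ w ⌋
                        → (⌊ z ⌋ ⊆ u) ⊎ (⌊ w ⌋ ⊆ ⌊ z ⌋))

    _↗_ : Rel₀ n → Rel₀ n → Set
    p ↗ u = Σ (Sub n) λ w → UpperCover u w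
              × (∀ (w' : Sub n) → UpperCover u w' → ⌊ w' ⌋ ≐ ⌊ w ⌋)
              × (p ⊆ ⌊ w ⌋) × ¬ (p ⊆ u)

module Submission where

-- Let q = p_{c,c,V} and u = q^⊥.  The proof computes the unique upper cover
-- of u in Reg(e) explicitly and then reduces p ↗ u to a statement about pairs.
--
--   1. q is open, i.e. e \ q is transitive, so u = cl(e \ q) is just e \ q.
--   2. w = (e \ q) ∪ {(c,c)} is closed and open, hence regular closed.
--   3. A transitive set containing u and some pair of q contains (c,c); hence
--      every regular closed z ⊇ u satisfies z ⊆ u or w ⊆ z.  By a general
--      lattice argument this makes w the unique upper cover of u, so that
--      p ↗ u  ⇔  p ⊆ w and p ⊈ u  ⇔  p ∩ q ⊆ {(c,c)} and (c,c) ∈ p.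
--   4. For p = p_{a,b,U}, containing the loop (c,c) forces a = b = c, and
--      p ∩ q ⊆ {(a,a)} unfolds to U ∩ V ⊆ {a} and Uᶜ ∩ Vᶜ ⊆ {a}.

open import Defs
open import Data.Nat using (ℕ)
open import Data.Fin using (Fin; _≟_)
open import Data.Bool using (T)
open import Data.Product using (_×_; _,_; proj₁; proj₂)
open import Data.Sum using (_⊎_; inj₁; inj₂)
open import Data.Empty using (⊥; ⊥-elim)
open import Function.Bundles using (_⇔_; mk⇔; Equivalence)
open import Function.Properties.Equivalence using () renaming (trans to ⇔-trans)
open import Relation.Nullary using (¬_; Dec; yes; no)
open import Relation.Nullary.Decidable
  using (isYes; toWitness; fromWitness; _×-dec_; _⊎-dec_; ¬?; T?)
open import Relation.Binary.PropositionalEquality using (_≡_; refl; sym)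

module Relations {n : ℕ} where

  indicator : (R : Rel₀ n) → (∀ x y → Dec (R x y)) → Sub n
  indicator R R? x y = isYes (R? x y)

  TC-least : ∀ {A B : Rel₀ n} → Transitive B → A ⊆ B → TC A ⊆ B
  TC-least B-trans A⊆B x y (step Axy) = A⊆B x y Axy
  TC-least B-trans A⊆B x z (trans {y = y} h h') =
    B-trans x y z (TC-least B-trans A⊆B x y h) (TC-least B-trans A⊆B y z h')

open Relations

module RegularClosed {n : ℕ} (e : Sub n) where

  Reg⇒Transitive : (z : Sub n) → Reg e ⌊ z ⌋ → Transitive ⌊ z ⌋
  Reg⇒Transitive z (_ , z⊆cl , cl⊆z) x y k zxy zyk =
    cl⊆z x k (trans (z⊆cl x y zxy) (z⊆cl y k zyk))

  -- A subset of e that is both closed and open is regular closed,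
  -- since it is then its own interior.
  clopen⇒Reg : (b : Sub n) → ⌊ b ⌋ ⊆ ⌊ e ⌋ → Transitive ⌊ b ⌋ → Open e ⌊ b ⌋
             → Reg e ⌊ b ⌋
  clopen⇒Reg b b⊆e b-trans b-open =
    b⊆e , (λ x y bxy → step (b , (λ _ _ t → t) , b-open , bxy)) , TC-least b-trans int⊆b
    where
      int⊆b : Int e ⌊ b ⌋ ⊆ ⌊ b ⌋
      int⊆b x y (b' , b'⊆b , _ , b'xy) = b'⊆b x y b'xy

  unique-cover : ∀ {u : Rel₀ n} (w : Sub n)
    → Reg e ⌊ w ⌋ → u ⊆ ⌊ w ⌋ → ¬ (⌊ w ⌋ ⊆ u)
    → (∀ (z : Sub n) → Reg e ⌊ z ⌋ → u ⊆ ⌊ z ⌋ → (⌊ z ⌋ ⊆ u) ⊎ (⌊ w ⌋ ⊆ ⌊ z ⌋))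
    → UpperCover e u w × (∀ (w' : Sub n) → UpperCover e u w' → ⌊ w' ⌋ ≐ ⌊ w ⌋)
  unique-cover {u} w w-reg u⊆w w⊈u split =
    (w-reg , u⊆w , w⊈u , λ z z-reg u⊆z _ → split z z-reg u⊆z) , unique
    where
      unique : ∀ (w' : Sub n) → UpperCover e u w' → ⌊ w' ⌋ ≐ ⌊ w ⌋
      unique w' (w'-reg , u⊆w' , w'⊈u , w'-covers) with split w' w'-reg u⊆w'
      ... | inj₁ w'⊆u = ⊥-elim (w'⊈u w'⊆u)
      ... | inj₂ w⊆w' with w'-covers w w-reg u⊆w w⊆w'
      ...   | inj₁ w⊆u  = ⊥-elim (w⊈u w⊆u)
      ...   | inj₂ w'⊆w = w'⊆w , w⊆w'

  ↗⇔below-cover : ∀ {p u : Rel₀ n} (w : Sub n) → UpperCover e u w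
    → (∀ (w' : Sub n) → UpperCover e u w' → ⌊ w' ⌋ ≐ ⌊ w ⌋)
    → (_↗_ e p u) ⇔ ((p ⊆ ⌊ w ⌋) × ¬ (p ⊆ u))
  ↗⇔below-cover w w-covers unique = mk⇔
    (λ (w₀ , w₀-covers , _ , p⊆w₀ , p⊈u) →
       (λ x y pxy → proj₁ (unique w₀ w₀-covers) x y (p⊆w₀ x y pxy)) , p⊈u)
    (λ (p⊆w , p⊈u) → w , w-covers , unique , p⊆w , p⊈u)

module Intervals {n : ℕ} (e : Sub n) (e-trans : Transitive ⌊ e ⌋) where

  -- The two coordinate sets of p_{a,b,U} = e ∩ (Src × Tgt).
  Src : Fin n → Fin n → SubE n → Fin n → Set
  Src a b U x = x ≡ a ⊎ (_∈[_,_] e x a b × ¬ T (U x))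

  Tgt : Fin n → SubE n → Fin n → Set
  Tgt b U y = y ≡ b ⊎ T (U y)

  ⊴-e : ∀ {x y z} → _⊴_ e x y → T (e y z) → T (e x z)
  ⊴-e {x} {y} {z} (inj₁ exy) eyz = e-trans x y z exy eyz
  ⊴-e (inj₂ refl) eyz = eyz

  e-⊴ : ∀ {x y z} → T (e x y) → _⊴_ e y z → T (e x z)
  e-⊴ {x} {y} {z} exy (inj₁ eyz) = e-trans x y z exy eyz
  e-⊴ exy (inj₂ refl) = exy

  ⊴-strict : ∀ {x y} → _⊴_ e x y → ¬ x ≡ y → T (e x y)
  ⊴-strict (inj₁ exy) _ = exy
  ⊴-strict (inj₂ x≡y) x≢y = ⊥-elim (x≢y x≡y)

  pJ? : ∀ a b U x y → Dec (pJ e a b U x y)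
  pJ? a b U x y = T? (e x y) ×-dec ((x ≟ a) ⊎-dec ((⊴? a x ×-dec ⊴? x b) ×-dec ¬? (T? (U x))))
                  ×-dec ((y ≟ b) ⊎-dec T? (U y))
    where
      ⊴? : ∀ x y → Dec (_⊴_ e x y)
      ⊴? x y = T? (e x y) ⊎-dec (x ≟ y)

  src∩tgt : ∀ {a x} U → Src a a U x → Tgt a U x → x ≡ a
  src∩tgt _ (inj₁ x≡a) _ = x≡a
  src∩tgt _ (inj₂ _) (inj₁ x≡a) = x≡a
  src∩tgt _ (inj₂ (_ , ¬Ux)) (inj₂ Ux) = ⊥-elim (¬Ux Ux)

  src∩tgt-empty : ∀ {a b U x} → InF e a b U → ¬ a ≡ b → Src a b U x → Tgt b U x → ⊥
  src∩tgt-empty _  a≢b (inj₁ refl) (inj₁ refl) = a≢b refl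
  src∩tgt-empty Fp a≢b (inj₁ refl) (inj₂ Ua)   = proj₁ (proj₂ (proj₂ Fp) a≢b) Ua
  src∩tgt-empty Fp a≢b (inj₂ (_ , ¬Ub)) (inj₁ refl) = ¬Ub (proj₂ (proj₂ (proj₂ Fp) a≢b))
  src∩tgt-empty _  _   (inj₂ (_ , ¬Ux)) (inj₂ Ux) = ¬Ux Ux

  pJ-loop : ∀ {a b c U} → InF e a b U → pJ e a b U c c → (a ≡ b) × (b ≡ c)
  pJ-loop {a} {b} {U = U} Fp (_ , src , tgt) with a ≟ b
  ... | yes refl = refl , sym (src∩tgt U src tgt)
  ... | no a≢b   = ⊥-elim (src∩tgt-empty Fp a≢b src tgt)

module PointCover {n : ℕ} (e : Sub n) (e-trans : Transitive ⌊ e ⌋)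
                  (c : Fin n) (V : SubE n) (Fq : InF e c c V) where

  open RegularClosed e
  open Intervals e e-trans

  q : Rel₀ n
  q = pJ e c c V

  q⊥ : Rel₀ n
  q⊥ = _⊥ e q

  ecc : T (e c c)
  ecc = proj₁ Fq

  qcc : q c c
  qcc = ecc , inj₁ refl , inj₁ refl

  src⇒∈ : ∀ {x} → Src c c V x → _∈[_,_] e x c c
  src⇒∈ (inj₁ refl) = inj₂ refl , inj₂ refl
  src⇒∈ (inj₂ (x∈ , _)) = x∈

  tgt⇒∈ : ∀ {y} → Tgt c V y → _∈[_,_] e y c c
  tgt⇒∈ (inj₁ refl) = inj₂ refl , inj₂ refl
  tgt⇒∈ (inj₂ Vy) = proj₁ (proj₂ Fq) _ Vy

  -- Step 1: q is open.  The middle point y of two e-pairs outside q whose ends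
  -- lie in Src × Tgt is in [c,c], so one of the two pairs would lie in q.
  q-open : Open e q
  q-open x y z (exy , ¬qxy) (eyz , ¬qyz) = e-trans x y z exy eyz , ¬qxz
    where
      middle : Src c c V x → Tgt c V z → Dec (T (V y)) → ⊥
      middle src-x _ (yes Vy) = ¬qxy (exy , src-x , inj₂ Vy)
      middle src-x tgt-z (no ¬Vy) = ¬qyz (eyz , inj₂ (y∈ , ¬Vy) , tgt-z)
        where
          y∈ : _∈[_,_] e y c c
          y∈ = inj₁ (⊴-e (proj₁ (src⇒∈ src-x)) exy) , inj₁ (e-⊴ eyz (proj₂ (tgt⇒∈ tgt-z)))
      ¬qxz : ¬ q x z
      ¬qxz (_ , src-x , tgt-z) = middle src-x tgt-z (T? (V y))

  q⊥⊆e∖q : q⊥ ⊆ diff e q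
  q⊥⊆e∖q = TC-least q-open (λ _ _ d → d)

  CoverRel : Rel₀ n
  CoverRel x y = T (e x y) × (¬ q x y ⊎ (x ≡ c × y ≡ c))

  cover : Sub n
  cover = indicator CoverRel λ x y →
    T? (e x y) ×-dec (¬? (pJ? c c V x y) ⊎-dec ((x ≟ c) ×-dec (y ≟ c)))

  cover-sound : ∀ {x y} → T (cover x y) → CoverRel x y
  cover-sound = toWitness

  cover-complete : ∀ {x y} → CoverRel x y → T (cover x y)
  cover-complete = fromWitness

  CoverRel-trans : Transitive CoverRel
  CoverRel-trans x y z (exy , xy) (eyz , yz) = e-trans x y z exy eyz , compose xy yz
    where
      compose : ¬ q x y ⊎ (x ≡ c × y ≡ c) → ¬ q y z ⊎ (y ≡ c × z ≡ c)
              → ¬ q x z ⊎ (x ≡ c × z ≡ c)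
      compose (inj₁ ¬qxy) (inj₁ ¬qyz) = inj₁ (proj₂ (q-open x y z (exy , ¬qxy) (eyz , ¬qyz)))
      compose (inj₁ ¬qxy) (inj₂ (refl , refl)) =
        inj₁ λ (_ , src-x , _) → ¬qxy (exy , src-x , inj₁ refl)
      compose (inj₂ (refl , refl)) (inj₁ ¬qyz) =
        inj₁ λ (_ , _ , tgt-z) → ¬qyz (eyz , inj₁ refl , tgt-z)
      compose (inj₂ (refl , refl)) (inj₂ (_ , refl)) = inj₂ (refl , refl)

  -- w is open: two consecutive e-pairs outside w both lie in q, so their
  -- middle point is c and the composite pair is in q \ {(c,c)} as well.
  cover-open : Open e ⌊ cover ⌋
  cover-open x y z (exy , ¬wxy) (eyz , ¬wyz) = e-trans x y z exy eyz , λ wxz →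
    in-q exy ¬wxy λ qxy → in-q eyz ¬wyz λ qyz → absurd qxy qyz (cover-sound wxz)
    where
      in-q : ∀ {s t} → T (e s t) → ¬ T (cover s t) → ¬ ¬ q s t
      in-q est ¬wst ¬qst = ¬wst (cover-complete (est , inj₁ ¬qst))
      absurd : q x y → q y z → ¬ CoverRel x z
      absurd (_ , src-x , _) (_ , _ , tgt-z) (_ , inj₁ ¬qxz) =
        ¬qxz (e-trans x y z exy eyz , src-x , tgt-z)
      absurd (_ , _ , tgt-y) (_ , src-y , _) (_ , inj₂ (x≡c , _)) =
        ¬wxy (cover-complete (exy , inj₂ (x≡c , src∩tgt V src-y tgt-y)))

  cover-reg : Reg e ⌊ cover ⌋
  cover-reg = clopen⇒Reg cover (λ _ _ w → proj₁ (cover-sound w))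
    (λ x y z w w' → cover-complete (CoverRel-trans x y z (cover-sound w) (cover-sound w')))
    cover-open

  q⊥⊆cover : q⊥ ⊆ ⌊ cover ⌋
  q⊥⊆cover x y h = let (exy , ¬qxy) = q⊥⊆e∖q x y h in cover-complete (exy , inj₁ ¬qxy)

  cover⊈q⊥ : ¬ (⌊ cover ⌋ ⊆ q⊥)
  cover⊈q⊥ w⊆q⊥ = proj₂ (q⊥⊆e∖q c c (w⊆q⊥ c c (cover-complete (ecc , inj₂ (refl , refl))))) qcc

  src-reach : ∀ {x} → Src c c V x → x ≡ c ⊎ diff e q c x
  src-reach (inj₁ x≡c) = inj₁ x≡c
  src-reach {x} (inj₂ ((c⊴x , _) , ¬Vx)) with x ≟ c
  ... | yes x≡c = inj₁ x≡c
  ... | no x≢c = inj₂ (⊴-strict c⊴x (λ c≡x → x≢c (sym c≡x)) , ¬qcx)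
    where
      ¬qcx : ¬ q c x
      ¬qcx (_ , _ , inj₁ x≡c) = x≢c x≡c
      ¬qcx (_ , _ , inj₂ Vx) = ¬Vx Vx

  tgt-reach : ∀ {y} → Tgt c V y → y ≡ c ⊎ diff e q y c
  tgt-reach (inj₁ y≡c) = inj₁ y≡c
  tgt-reach {y} (inj₂ Vy) with y ≟ c
  ... | yes y≡c = inj₁ y≡c
  ... | no y≢c = inj₂ (⊴-strict (proj₂ (tgt⇒∈ (inj₂ Vy))) y≢c , ¬qyc)
    where
      ¬qyc : ¬ q y c
      ¬qyc (_ , inj₁ y≡c , _) = y≢c y≡c
      ¬qyc (_ , inj₂ (_ , ¬Vy) , _) = ¬Vy Vy

  q-forces-loop : (z : Sub n) → Transitive ⌊ z ⌋ → q⊥ ⊆ ⌊ z ⌋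
                → ∀ x y → q x y → T (z x y) → T (z c c)
  q-forces-loop z z-trans q⊥⊆z x y (_ , src-x , tgt-y) zxy =
    to-c (tgt-reach tgt-y) (from-c (src-reach src-x))
    where
      from-c : x ≡ c ⊎ diff e q c x → T (z c y)
      from-c (inj₁ refl) = zxy
      from-c (inj₂ d) = z-trans c x y (q⊥⊆z c x (step d)) zxy
      to-c : y ≡ c ⊎ diff e q y c → T (z c y) → T (z c c)
      to-c (inj₁ refl) zcy = zcy
      to-c (inj₂ d) zcy = z-trans c y c zcy (q⊥⊆z y c (step d))

  -- Every regular closed set above q^⊥ is either below q^⊥ or above w,
  -- according to whether it contains (c,c).
  above-q⊥ : ∀ (z : Sub n) → Reg e ⌊ z ⌋ → q⊥ ⊆ ⌊ z ⌋ → (⌊ z ⌋ ⊆ q⊥) ⊎ (⌊ cover ⌋ ⊆ ⌊ z ⌋)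
  above-q⊥ z z-reg q⊥⊆z with T? (z c c)
  ... | yes zcc = inj₂ λ x y wxy → above (cover-sound wxy)
    where
      above : ∀ {x y} → CoverRel x y → T (z x y)
      above (exy , inj₁ ¬qxy) = q⊥⊆z _ _ (step (exy , ¬qxy))
      above (_ , inj₂ (refl , refl)) = zcc
  ... | no ¬zcc = inj₁ λ x y zxy →
    step (proj₁ z-reg x y zxy ,
          λ qxy → ¬zcc (q-forces-loop z (Reg⇒Transitive z z-reg) q⊥⊆z x y qxy zxy))

  cover-unique : UpperCover e q⊥ cover
               × (∀ (w' : Sub n) → UpperCover e q⊥ w' → ⌊ w' ⌋ ≐ ⌊ cover ⌋)
  cover-unique = unique-cover cover cover-reg q⊥⊆cover cover⊈q⊥ above-q⊥

  MeetsOnlyAtLoop : Rel₀ n → Set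
  MeetsOnlyAtLoop p = ∀ x y → p x y → q x y → x ≡ c × y ≡ c

  below-cover⇔ : ∀ {p : Rel₀ n} → p ⊆ ⌊ e ⌋ → Dec (p c c)
    → ((p ⊆ ⌊ cover ⌋) × ¬ (p ⊆ q⊥)) ⇔ (MeetsOnlyAtLoop p × p c c)
  below-cover⇔ {p} p⊆e pcc? = mk⇔
    (λ (p⊆w , p⊈q⊥) → meets p⊆w , loop p⊆w p⊈q⊥ pcc?)
    (λ (meets-only , pcc) →
      (λ x y pxy → cover-complete (p⊆e x y pxy , in-cover meets-only pxy (pJ? c c V x y))) ,
      (λ p⊆q⊥ → proj₂ (q⊥⊆e∖q c c (p⊆q⊥ c c pcc)) qcc))
    where
      meets : p ⊆ ⌊ cover ⌋ → MeetsOnlyAtLoop p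
      meets p⊆w x y pxy qxy with cover-sound (p⊆w x y pxy)
      ... | (_ , inj₁ ¬qxy) = ⊥-elim (¬qxy qxy)
      ... | (_ , inj₂ loop) = loop
      loop : p ⊆ ⌊ cover ⌋ → ¬ (p ⊆ q⊥) → Dec (p c c) → p c c
      loop _ _ (yes pcc) = pcc
      loop p⊆w p⊈q⊥ (no ¬pcc) = ⊥-elim (p⊈q⊥ λ x y pxy → in-q⊥ pxy (cover-sound (p⊆w x y pxy)))
        where
          in-q⊥ : ∀ {x y} → p x y → CoverRel x y → q⊥ x y
          in-q⊥ _ (exy , inj₁ ¬qxy) = step (exy , ¬qxy)
          in-q⊥ pcc (_ , inj₂ (refl , refl)) = ⊥-elim (¬pcc pcc)
      in-cover : MeetsOnlyAtLoop p → ∀ {x y} → p x y → Dec (q x y) → ¬ q x y ⊎ (x ≡ c × y ≡ c)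
      in-cover meets-only pxy (yes qxy) = inj₂ (meets-only _ _ pxy qxy)
      in-cover _ _ (no ¬qxy) = inj₁ ¬qxy

  ↗q⊥⇔ : ∀ {p : Rel₀ n} → p ⊆ ⌊ e ⌋ → Dec (p c c)
       → (_↗_ e p q⊥) ⇔ (MeetsOnlyAtLoop p × p c c)
  ↗q⊥⇔ p⊆e pcc? = ⇔-trans
    (↗⇔below-cover cover (proj₁ cover-unique) (proj₂ cover-unique))
    (below-cover⇔ p⊆e pcc?)


module Overlap {n : ℕ} (e : Sub n) (e-trans : Transitive ⌊ e ⌋) where

  open Intervals e e-trans
  open Equivalence using (to; from)

  -- Two point-type join-irreducibles p_{a,a,U} and p_{a,a,V} meet only in
  -- (a,a) iff U ∩ V ⊆ {a} and Uᶜ ∩ Vᶜ ⊆ {a}: the pairs (a,x), x ∈ U ∩ V, and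
  -- (x,a), x ∈ Uᶜ ∩ Vᶜ, lie in both, and every common pair is of this shape.
  point-overlap⇔ : ∀ {a U V} → InF e a a U
    → (∀ x y → pJ e a a U x y → pJ e a a V x y → x ≡ a × y ≡ a)
      ⇔ ((∀ x → T (U x) → T (V x) → x ≡ a)
         × (∀ x → (_∈[_,_] e x a a × ¬ T (U x)) → (_∈[_,_] e x a a × ¬ T (V x)) → x ≡ a))
  point-overlap⇔ {a} {U} {V} Fp = mk⇔
    (λ meets → (λ x Ux Vx → let eax = e-⊴ eaa (proj₁ (proj₁ (proj₂ Fp) x Ux)) in
                  proj₂ (meets a x (eax , inj₁ refl , inj₂ Ux) (eax , inj₁ refl , inj₂ Vx))) ,
               (λ x x∉U x∉V → let exa = ⊴-e (proj₂ (proj₁ x∉U)) eaa in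
                  proj₁ (meets x a (exa , inj₂ x∉U , inj₁ refl) (exa , inj₂ x∉V , inj₁ refl))))
    (λ (U∩V , Uᶜ∩Vᶜ) x y (_ , srcU , tgtU) (_ , srcV , tgtV) →
       common-src Uᶜ∩Vᶜ srcU srcV , common-tgt U∩V tgtU tgtV)
    where
      eaa : T (e a a)
      eaa = proj₁ Fp
      common-src : (∀ x → (_∈[_,_] e x a a × ¬ T (U x)) → (_∈[_,_] e x a a × ¬ T (V x)) → x ≡ a)
                 → ∀ {x} → Src a a U x → Src a a V x → x ≡ a
      common-src _ (inj₁ x≡a) _ = x≡a
      common-src _ (inj₂ _) (inj₁ x≡a) = x≡a
      common-src Uᶜ∩Vᶜ (inj₂ x∉U) (inj₂ x∉V) = Uᶜ∩Vᶜ _ x∉U x∉V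
      common-tgt : (∀ x → T (U x) → T (V x) → x ≡ a)
                 → ∀ {y} → Tgt a U y → Tgt a V y → y ≡ a
      common-tgt _ (inj₁ y≡a) _ = y≡a
      common-tgt _ (inj₂ _) (inj₁ y≡a) = y≡a
      common-tgt U∩V (inj₂ Uy) (inj₂ Vy) = U∩V _ Uy Vy

  LoopOverlap : Fin n → Fin n → Fin n → SubE n → SubE n → Set
  LoopOverlap a b c U V =
    (∀ x y → pJ e a b U x y → pJ e c c V x y → x ≡ c × y ≡ c) × pJ e a b U c c

  PointConditions : Fin n → Fin n → Fin n → SubE n → SubE n → Set
  PointConditions a b c U V = (a ≡ b) × (b ≡ c)
    × (∀ x → T (U x) → T (V x) → x ≡ a)
    × (∀ x → (_∈[_,_] e x a b × ¬ T (U x)) → (_∈[_,_] e x c c × ¬ T (V x)) → x ≡ a)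

  loop-overlap⇒conditions : ∀ {a b c U V} → InF e a b U
                          → LoopOverlap a b c U V → PointConditions a b c U V
  loop-overlap⇒conditions Fp (meets , pcc) with pJ-loop Fp pcc
  ... | refl , refl = refl , refl , to (point-overlap⇔ Fp) meets

  conditions⇒loop-overlap : ∀ {a b c U V} → InF e a b U
                          → PointConditions a b c U V → LoopOverlap a b c U V
  conditions⇒loop-overlap Fp (refl , refl , overlaps) =
    from (point-overlap⇔ Fp) overlaps , (proj₁ Fp , inj₁ refl , inj₁ refl)

lemma6p3 : (n : ℕ) (e : Sub n) → Transitive ⌊ e ⌋
    → (a b c : Fin n) (U V : SubE n) → InF e a b U → InF e c c V
    → (_↗_ e (pJ e a b U) (_⊥ e (pJ e c c V)))
      ⇔ ((a ≡ b) × (b ≡ c)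
         × (∀ x → T (U x) → T (V x) → x ≡ a)
         × (∀ x → (_∈[_,_] e x a b × ¬ T (U x)) → (_∈[_,_] e x c c × ¬ T (V x)) → x ≡ a))
lemma6p3 n e e-trans a b c U V Fp Fq =
  ⇔-trans (↗q⊥⇔ (λ _ _ pxy → proj₁ pxy) (pJ? a b U c c))
          (mk⇔ (loop-overlap⇒conditions Fp) (conditions⇒loop-overlap Fp))
  where
    open Intervals e e-trans using (pJ?)
    open PointCover e e-trans c V Fq using (↗q⊥⇔)
    open Overlap e e-trans using (loop-overlap⇒conditions; conditions⇒loop-overlap)
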